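{- Let $D$ be a rooted dag and consider an execution of MaxLeaves-12MIS on $D$ with any subroutine $\mathcal{A}$ returning an independent set $I$ of $(G,w)$. Let $F_1$ be the branching of step (1), let $F_2$ be the branching obtained from $F_1$ by adding, for each $x\in I$ with $w_x=2$ and underlying node $v$, the arcs $\{vu:u\in U_x\}$, let $F_3$ be the branching obtained from $F_1$ by adding these arcs for every $x\in I$, and let $T$ be the returned arborescence. For $i=1,2,3$ let $k_i$ be the number of non-trivial components (components with at least one arc) of $F_i$ and $N_i$ the total number of nodes in these components. Then $$\ell(T)\ \ge\ \frac{N_1-k_1}{12}+\frac{N_2-k_2}{6}+\frac{N_3-k_3}{2}+1,$$ where $\ell(T)$ is the number of leaves of $T$.
   Context: Digraphs: a node $r$ of a digraph $D$ is a root if $D$ has a directed path from $r$ to every node; $D$ is rooted if it has a root. A dag is a digraph with no directed cycle. An arborescence is an $r$-rooted digraph with a unique directed path from $r$ to every node. A branching is a collection of vertex-disjoint arborescences; spanning if it contains every node. A leaf is a node of out-degree 0. GreedyExpand$(D,t,F)$: set $F'\leftarrow F$; go through the nodes $v$ in arbitrary order; for each $v$ with out-degree 0 in the current $F'$, let $A_v$ be the arcs $vu$ of $D$ with $u$ of in-degree 0 in $F'$; if $|A_v|\ge t$ add $A_v$ to $F'$. Return $F'$. MaxLeaves-12MIS$(D)$ with subroutine $\mathcal{A}$ (input: rooted dag $D$): (1) $F_1$ := GreedyExpand$(D,4,F_0)$ where $F_0$ is the spanning branching with no arcs. (2) For each node $v$ with out-degree 0 in $F_1$, $U_v$ := nodes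 $u$ with in-degree 0 in $F_1$ and $vu\in A(D)$. (3) Candidates := nodes $v$ with out-degree 0 in $F_1$ and $2\le|U_v|\le3$; for each such $v$ with $|U_v|=3$ and each $u\in U_v$ add a new element $v_u$ with $U_{v_u}=U_v\setminus\{u\}$ and underlying node $v$ (nodes are their own underlying node). (4) $G$ := multigraph on Candidates with $|U_x\cap U_y|$ parallel edges between distinct $x,y$; weights $w_x=|U_x|-1$. (5) $I$ := $\mathcal{A}(G,w)$, an independent set of $G$. (6) Add to $F_1$, for each $x\in I$ with underlying node $v$, the arcs $\{vu:u\in U_x\}$. (7) Return $T$ := GreedyExpand$(D,1,\cdot)$ applied to the branching of step (6). -}

module Defs where

open import Data.Bool using (Bool; true; false; _∧_; _∨_; not; if_then_else_)
open import Data.Nat using (ℕ; zero; suc; _≡ᵇ_; _≤ᵇ_; _<ᵇ_)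
open import Data.Fin using (Fin; toℕ; _≟_)
open import Data.Maybe using (Maybe; just; nothing)
open import Data.Product using (_×_; _,_; Σ; ∃)
open import Data.List using (List; []; _∷_; length; filterᵇ; allFin; foldl; map)
open import Data.Bool.ListAction using (any; all)
open import Relation.Nullary using (¬_)
open import Data.Empty using (⊥)
open import Relation.Nullary.Decidable using (⌊_⌋)
open import Relation.Binary.PropositionalEquality using (_≡_; _≢_)

-- A digraph / arc set on node set Fin n : a Boolean arc relation (a v u = true iff vu is an arc).
Arcs : ℕ → Set
Arcs n = Fin n → Fin n → Bool

module _ {n : ℕ} where

  nodes : List (Fin n)
  nodes = allFin n

  countB : (Fin n → Bool) → ℕ
  countB p = length (filterᵇ p nodes)

  outdeg : Arcs n → Fin n → ℕ
  outdeg F v = countB (λ u → F v u)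

  indeg : Arcs n → Fin n → ℕ
  indeg F u = countB (λ v → F v u)

  data Reach (D : Arcs n) : Fin n → Fin n → Set where
    here : ∀ {v} → Reach D v v
    step : ∀ {u w v} → D u w ≡ true → Reach D w v → Reach D u v

  IsRoot : Arcs n → Fin n → Set
  IsRoot D r = ∀ v → Reach D r v

  Rooted : Arcs n → Set
  Rooted D = ∃ λ r → IsRoot D r

  -- no directed cycle (an arc uv plus a path v ⇝ u would close a cycle; loops included)
  IsDag : Arcs n → Set
  IsDag D = ∀ u v → D u v ≡ true → ¬ Reach D v u

  union : Arcs n → Arcs n → Arcs n
  union F G v u = F v u ∨ G v u

  emptyArcs : Arcs n
  emptyArcs _ _ = false

  Aset : Arcs n → Arcs n → Fin n → Arcs n
  Aset D F v v' u = ⌊ v' ≟ v ⌋ ∧ D v u ∧ (indeg F u ≡ᵇ 0)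

  greedyStep : Arcs n → ℕ → Arcs n → Fin n → Arcs n
  greedyStep D t F v =
    if (outdeg F v ≡ᵇ 0) ∧ (t ≤ᵇ outdeg (Aset D F v) v)
    then union F (Aset D F v)
    else F

  greedyExpand : Arcs n → ℕ → List (Fin n) → Arcs n → Arcs n
  greedyExpand D t ord F = foldl (greedyStep D t) F ord

  adj : Arcs n → Fin n → Fin n → Bool
  adj F u v = F u v ∨ F v u

  reachK : Arcs n → ℕ → Fin n → Fin n → Bool
  reachK F zero u v = ⌊ u ≟ v ⌋
  reachK F (suc k) u v = reachK F k u v ∨ any (λ w → reachK F k u w ∧ adj F w v) nodes

  sameComp : Arcs n → Fin n → Fin n → Bool
  sameComp F u v = reachK F n u v

  inNontrivial : Arcs n → Fin n → Bool
  inNontrivial F v = any (λ w → sameComp F v w ∧ (0 <ᵇ outdeg F w)) nodes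

  Ncomp : Arcs n → ℕ
  Ncomp F = countB (inNontrivial F)

  -- k(F): number of non-trivial components, counted by their least node
  kcomp : Arcs n → ℕ
  kcomp F = countB (λ v → inNontrivial F v ∧
                      all (λ w → not ((toℕ w <ᵇ toℕ v) ∧ sameComp F v w)) nodes)

  leaves : Arcs n → ℕ
  leaves F = countB (λ v → outdeg F v ≡ᵇ 0)

  F₁ : Arcs n → List (Fin n) → Arcs n
  F₁ D ord₁ = greedyExpand D 4 ord₁ emptyArcs

  -- U_v (meaningful for v a leaf of F1): u of in-degree 0 in F1 with vu ∈ A(D)
  Uv : Arcs n → List (Fin n) → Fin n → Fin n → Bool
  Uv D ord₁ v u = D v u ∧ (indeg (F₁ D ord₁) u ≡ᵇ 0)

  sizeU : Arcs n → List (Fin n) → Fin n → ℕ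
  sizeU D ord₁ v = countB (Uv D ord₁ v)

  -- Elements of G: (v , nothing) is node v; (v , just u) is the new element v_u.
  Elem : Set
  Elem = Fin n × Maybe (Fin n)

  isCandidate : Arcs n → List (Fin n) → Elem → Bool
  isCandidate D ord₁ (v , nothing) =
    (outdeg (F₁ D ord₁) v ≡ᵇ 0) ∧ (2 ≤ᵇ sizeU D ord₁ v) ∧ (sizeU D ord₁ v ≤ᵇ 3)
  isCandidate D ord₁ (v , just u) =
    (outdeg (F₁ D ord₁) v ≡ᵇ 0) ∧ (sizeU D ord₁ v ≡ᵇ 3) ∧ Uv D ord₁ v u

  Ux : Arcs n → List (Fin n) → Elem → Fin n → Bool
  Ux D ord₁ (v , nothing) u' = Uv D ord₁ v u'
  Ux D ord₁ (v , just u) u' = Uv D ord₁ v u' ∧ not ⌊ u ≟ u' ⌋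

  sizeUx : Arcs n → List (Fin n) → Elem → ℕ
  sizeUx D ord₁ x = countB (Ux D ord₁ x)

  -- I is an independent set of the multigraph G: I ⊆ Candidates and no two distinct
  -- members x, y are joined by an edge, i.e. |U_x ∩ U_y| = 0.
  IsIndependent : Arcs n → List (Fin n) → (Elem → Bool) → Set
  IsIndependent D ord₁ I =
    (∀ x → I x ≡ true → isCandidate D ord₁ x ≡ true) ×
    (∀ x y → I x ≡ true → I y ≡ true → x ≢ y →
       ∀ u → Ux D ord₁ x u ≡ true → Ux D ord₁ y u ≡ true → ⊥)

  elemsAt : Fin n → List Elem
  elemsAt v = (v , nothing) ∷ map (λ u → (v , just u)) nodes

  addArcs : Arcs n → List (Fin n) → (Elem → Bool) → (Elem → Bool) → Arcs n
  addArcs D ord₁ I sel v u =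
    F₁ D ord₁ v u ∨ any (λ x → I x ∧ sel x ∧ Ux D ord₁ x u) (elemsAt v)

  -- weight w_x = |U_x| - 1 equals 2
  weight2 : Arcs n → List (Fin n) → Elem → Bool
  weight2 D ord₁ x = sizeUx D ord₁ x ≡ᵇ 3

  F₂ : Arcs n → List (Fin n) → (Elem → Bool) → Arcs n
  F₂ D ord₁ I = addArcs D ord₁ I (weight2 D ord₁)

  F₃ : Arcs n → List (Fin n) → (Elem → Bool) → Arcs n
  F₃ D ord₁ I = addArcs D ord₁ I (λ _ → true)

  Tout : Arcs n → List (Fin n) → List (Fin n) → (Elem → Bool) → Arcs n
  Tout D ord₁ ord₂ I = greedyExpand D 1 ord₂ (F₃ D ord₁ I)

{-# OPTIONS --safe #-}
-- In a branching F every node of a non-trivial component except its root has an in-arc, so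
-- N(F) − k(F) ≤ |A(F)|; F₂ and F₃ are branchings because I is independent. It then suffices that
-- |A(F₁)| + 2|A(F₂)| + 6|A(F₃)| ≤ 12 Σ_v (d⁺_T(v) − 1) ≤ 12 (ℓ(T) − 1), the last step because T is a
-- branching in which the root of D has no in-arc (D is a dag). The first inequality holds node by
-- node: a node of out-degree ≥ 4 in F₁ keeps exactly these arcs in F₂, F₃ and T; a node carrying a
-- chosen x ∈ I has the arcs to U_x in F₃ and T, and in F₂ only when w_x = 2; every other node has
-- no arcs in F₁, F₂, F₃.
module Submission where

open import Defs
open import Data.Bool using (Bool; true; false; _∧_; _∨_; not; if_then_else_; T)
open import Data.Bool.Properties using (T-≡; ¬-not; ∧-zeroʳ; ∧-identityʳ; ∨-identityʳ; ∨-zeroʳ)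
  renaming (_≟_ to _≟ᴮ_)
open import Data.Bool.ListAction using (any; all)
open import Data.Nat using (ℕ; zero; suc; _+_; _*_; _∸_; _≤_; _<_; z≤n; s≤s; _≡ᵇ_; _≤ᵇ_; _<ᵇ_; _≤?_)
open import Data.Nat.Properties
  using (≤-refl; ≤-trans; ≤-reflexive; +-mono-≤; +-monoˡ-≤; +-monoʳ-≤; *-monoʳ-≤; +-cancelˡ-≤;
         m≤m+n; ≤-pred; +-comm; +-suc; *-suc;
         ≡ᵇ⇒≡; ≤ᵇ⇒≤; <ᵇ⇒<; <⇒<ᵇ; +-*-semiring; +-commutativeSemigroup; module ≤-Reasoning)
open import Data.Nat.Tactic.RingSolver using (solve-∀)
open import Algebra.Properties.CommutativeSemigroup +-commutativeSemigroup using (x∙yz≈y∙xz)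
open import Data.Fin using (Fin; zero; suc; toℕ; _≟_)
open import Data.Fin.Properties using (suc-injective; any?)
open import Data.List using (List; []; _∷_; length; filterᵇ; tabulate; allFin)
open import Data.List.Membership.Propositional using (_∈_; find; lose)
open import Data.List.Membership.Propositional.Properties using (∈-allFin; ∈-map⁺; ∈-map⁻)
open import Data.List.Relation.Unary.Any using (here; there)
open import Data.List.Relation.Unary.Any.Properties using (any⁺; any⁻)
open import Data.List.Relation.Unary.All.Properties using (all⁻)
open import Data.List.Relation.Unary.All as All using ()
open import Data.List.Relation.Binary.Permutation.Propositional using (_↭_)
open import Data.Maybe using (just; nothing)
open import Data.Maybe.Properties using (≡-dec)
open import Data.Empty using (⊥-elim)
open import Data.Product using (_×_; _,_; ∃; proj₁; proj₂)
open import Data.Sum using (_⊎_; inj₁; inj₂)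
open import Function using (_∘_; id; Equivalence)
open import Relation.Nullary using (¬_; Dec; yes; no; contradiction)
open import Relation.Nullary.Decidable
  using (⌊_⌋; isYes≗does; decidable-stable; dec-true; dec-false; ¬¬-excluded-middle)
open import Relation.Binary.PropositionalEquality
open import Algebra.Properties.Semiring.Sum +-*-semiring
  using (sum; sum-syntax; sum-cong-≗; sum-replicate-zero; ∑-distrib-+; ∑-comm; *-distribˡ-sum)

≡true⇒T : ∀ {b} → b ≡ true → T b
≡true⇒T = Equivalence.from T-≡

T⇒≡true : ∀ {b} → T b → b ≡ true
T⇒≡true = Equivalence.to T-≡

∧-true⁻ : ∀ {a b} → a ∧ b ≡ true → a ≡ true × b ≡ true
∧-true⁻ {true} b≡true = refl , b≡true

∧-true⁺ : ∀ {a b} → a ≡ true → b ≡ true → a ∧ b ≡ true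
∧-true⁺ refl refl = refl

∨-true⁻ : ∀ {a b} → a ∨ b ≡ true → a ≡ true ⊎ b ≡ true
∨-true⁻ {true} _ = inj₁ refl
∨-true⁻ {false} b≡true = inj₂ b≡true

≡ᵇ-true⇒≡ : ∀ {m n} → (m ≡ᵇ n) ≡ true → m ≡ n
≡ᵇ-true⇒≡ {m} {n} = ≡ᵇ⇒≡ m n ∘ ≡true⇒T

≤ᵇ-true⇒≤ : ∀ {m n} → (m ≤ᵇ n) ≡ true → m ≤ n
≤ᵇ-true⇒≤ {m} {n} = ≤ᵇ⇒≤ m n ∘ ≡true⇒T

any-true⁻ : ∀ {A : Set} (g : A → Bool) xs → any g xs ≡ true → ∃ λ x → x ∈ xs × g x ≡ true
any-true⁻ g xs e with find (any⁻ g xs (≡true⇒T e))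
... | x , x∈xs , gx = x , x∈xs , T⇒≡true gx

any-true⁺ : ∀ {A : Set} (g : A → Bool) {xs x} → x ∈ xs → g x ≡ true → any g xs ≡ true
any-true⁺ g x∈xs gx = T⇒≡true (any⁺ g (lose x∈xs (≡true⇒T gx)))

any-false : ∀ {A : Set} (g : A → Bool) xs → (∀ {x} → x ∈ xs → g x ≢ true) → any g xs ≡ false
any-false g xs none = ¬-not λ e → let x , x∈xs , gx = any-true⁻ g xs e in none x∈xs gx

all-true : ∀ {A : Set} (g : A → Bool) xs → (∀ x → g x ≡ true) → all g xs ≡ true
all-true g xs every = T⇒≡true (all⁻ g (All.tabulate {xs = xs} λ {x} _ → ≡true⇒T (every x)))

⌊≟⌋-refl : ∀ {n} (a : Fin n) → ⌊ a ≟ a ⌋ ≡ true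
⌊≟⌋-refl a = trans (isYes≗does (a ≟ a)) (dec-true (a ≟ a) refl)

⌊≟⌋-≢ : ∀ {n} {a b : Fin n} → a ≢ b → ⌊ a ≟ b ⌋ ≡ false
⌊≟⌋-≢ {a = a} {b} a≢b = trans (isYes≗does (a ≟ b)) (dec-false (a ≟ b) a≢b)

𝟙 : Bool → ℕ
𝟙 true = 1
𝟙 false = 0

length-filter-tabulate : ∀ {A : Set} {n} (p : A → Bool) (g : Fin n → A) →
  length (filterᵇ p (tabulate g)) ≡ ∑[ i < n ] 𝟙 (p (g i))
length-filter-tabulate {n = zero} p g = refl
length-filter-tabulate {n = suc n} p g with p (g zero)
... | true = cong suc (length-filter-tabulate p (g ∘ suc))
... | false = length-filter-tabulate p (g ∘ suc)

countB≡∑ : ∀ {n} (p : Fin n → Bool) → countB p ≡ ∑[ i < n ] 𝟙 (p i)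
countB≡∑ p = length-filter-tabulate p id

sum-mono-≤ : ∀ {n} {f g : Fin n → ℕ} → (∀ i → f i ≤ g i) → sum f ≤ sum g
sum-mono-≤ {zero} _ = z≤n
sum-mono-≤ {suc n} f≤g = +-mono-≤ (f≤g zero) (sum-mono-≤ (f≤g ∘ suc))

∑-const-1 : ∀ n → ∑[ i < n ] 1 ≡ n
∑-const-1 zero = refl
∑-const-1 (suc n) = cong suc (∑-const-1 n)

∑𝟙-extract : ∀ {n} (r : Fin n) (q : Fin n → Bool) →
  ∑[ i < n ] 𝟙 (q i) ≡ 𝟙 (q r) + ∑[ i < n ] 𝟙 (if ⌊ r ≟ i ⌋ then false else q i)
∑𝟙-extract zero q = refl
∑𝟙-extract {suc n} (suc r) q = begin
  𝟙 (q zero) + ∑[ i < n ] 𝟙 (q (suc i))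
    ≡⟨ cong (𝟙 (q zero) +_) (∑𝟙-extract r (q ∘ suc)) ⟩
  𝟙 (q zero) + (𝟙 (q (suc r)) + ∑[ i < n ] 𝟙 (if ⌊ r ≟ i ⌋ then false else q (suc i)))
    ≡⟨ x∙yz≈y∙xz (𝟙 (q zero)) (𝟙 (q (suc r))) _ ⟩
  𝟙 (q (suc r)) + (𝟙 (q zero) + ∑[ i < n ] 𝟙 (if ⌊ r ≟ i ⌋ then false else q (suc i)))
    ≡⟨ cong (λ s → 𝟙 (q (suc r)) + (𝟙 (q zero) + s)) (sum-cong-≗ shifted) ⟩
  𝟙 (q (suc r)) + (𝟙 (q zero) + ∑[ i < n ] 𝟙 (if ⌊ suc r ≟ suc i ⌋ then false else q (suc i))) ∎
  where
  open ≡-Reasoning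
  shifted : ∀ i → 𝟙 (if ⌊ r ≟ i ⌋ then false else q (suc i))
                ≡ 𝟙 (if ⌊ suc r ≟ suc i ⌋ then false else q (suc i))
  shifted i with r ≟ i
  ... | yes _ = refl
  ... | no _ = refl

∑𝟙-injective-≤ : ∀ {m n} (p : Fin m → Bool) (q : Fin n → Bool) (f : Fin m → Fin n) →
  (∀ {i} → p i ≡ true → q (f i) ≡ true) →
  (∀ {i j} → p i ≡ true → p j ≡ true → f i ≡ f j → i ≡ j) →
  ∑[ i < m ] 𝟙 (p i) ≤ ∑[ j < n ] 𝟙 (q j)
∑𝟙-injective-≤ {zero} p q f maps inj = z≤n
∑𝟙-injective-≤ {suc m} {n} p q f maps inj with p zero in p₀
... | false = ∑𝟙-injective-≤ (p ∘ suc) q (f ∘ suc) maps (λ pi pj → suc-injective ∘ inj pi pj)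
... | true = begin
  suc (∑[ i < m ] 𝟙 (p (suc i)))
    ≤⟨ s≤s (∑𝟙-injective-≤ (p ∘ suc) q′ (f ∘ suc) maps′ (λ pi pj → suc-injective ∘ inj pi pj)) ⟩
  suc (∑[ j < n ] 𝟙 (q′ j))
    ≡⟨ cong (λ b → 𝟙 b + ∑[ j < n ] 𝟙 (q′ j)) (sym (maps p₀)) ⟩
  𝟙 (q (f zero)) + ∑[ j < n ] 𝟙 (q′ j)
    ≡⟨ sym (∑𝟙-extract (f zero) q) ⟩
  ∑[ j < n ] 𝟙 (q j) ∎
  where
  open ≤-Reasoning
  q′ : Fin n → Bool
  q′ j = if ⌊ f zero ≟ j ⌋ then false else q j
  maps′ : ∀ {i} → p (suc i) ≡ true → q′ (f (suc i)) ≡ true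
  maps′ {i} pi with f zero ≟ f (suc i)
  ... | yes f₀≡fi with () ← inj p₀ pi f₀≡fi
  ... | no _ rewrite maps pi = refl

count-injective-≤ : ∀ {m n} (p : Fin m → Bool) (q : Fin n → Bool) (f : Fin m → Fin n) →
  (∀ {i} → p i ≡ true → q (f i) ≡ true) →
  (∀ {i j} → p i ≡ true → p j ≡ true → f i ≡ f j → i ≡ j) →
  countB p ≤ countB q
count-injective-≤ p q f maps inj
  rewrite countB≡∑ p | countB≡∑ q = ∑𝟙-injective-≤ p q f maps inj

module _ {n : ℕ} where

  count-cong : {p q : Fin n → Bool} → (∀ i → p i ≡ q i) → countB p ≡ countB q
  count-cong {p} {q} p≗q = begin
    countB p                 ≡⟨ countB≡∑ p ⟩
    ∑[ i < n ] 𝟙 (p i)       ≡⟨ sum-cong-≗ (cong 𝟙 ∘ p≗q) ⟩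
    ∑[ i < n ] 𝟙 (q i)       ≡⟨ countB≡∑ q ⟨
    countB q                 ∎
    where open ≡-Reasoning

  count-none : {p : Fin n → Bool} → (∀ i → p i ≡ false) → countB p ≡ 0
  count-none {p} none = begin
    countB p                 ≡⟨ count-cong none ⟩
    countB {n} (λ _ → false) ≡⟨ countB≡∑ {n} (λ _ → false) ⟩
    ∑[ i < n ] 0             ≡⟨ sum-replicate-zero n ⟩
    0                        ∎
    where open ≡-Reasoning

  count-witness : {p : Fin n → Bool} {i : Fin n} → p i ≡ true → 1 ≤ countB p
  count-witness {p} {i} pi =
    count-injective-≤ {1} (λ _ → true) p (λ _ → i) (λ _ → pi) λ { {zero} {zero} _ _ _ → refl }

  count≤1 : {p : Fin n → Bool} → (∀ {i j} → p i ≡ true → p j ≡ true → i ≡ j) → countB p ≤ 1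
  count≤1 {p} unique =
    count-injective-≤ {n = 1} p (λ _ → true) (λ _ → zero) (λ _ → refl) (λ pi pj _ → unique pi pj)

  count-positive : {p : Fin n → Bool} → 1 ≤ countB p → ∃ λ i → p i ≡ true
  count-positive {p} 1≤count with any? (λ i → p i ≟ᴮ true)
  ... | yes witness = witness
  ... | no none =
    contradiction (≤-trans 1≤count (≤-reflexive (count-none (λ i → ¬-not (none ∘ (i ,_)))))) λ ()

  count-zero : {p : Fin n → Bool} → countB p ≡ 0 → ∀ i → p i ≡ false
  count-zero {p} count≡0 i =
    ¬-not λ pi → contradiction (≤-trans (count-witness pi) (≤-reflexive count≡0)) λ ()

  count-remove : (p : Fin n → Bool) (a : Fin n) → countB p ≤ suc (countB (λ i → p i ∧ not ⌊ a ≟ i ⌋))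
  count-remove p a = begin
    countB p
      ≡⟨ countB≡∑ p ⟩
    ∑[ i < n ] 𝟙 (p i)
      ≡⟨ ∑𝟙-extract a p ⟩
    𝟙 (p a) + ∑[ i < n ] 𝟙 (if ⌊ a ≟ i ⌋ then false else p i)
      ≤⟨ +-mono-≤ (𝟙≤1 (p a)) (≤-reflexive (sum-cong-≗ λ i → cong 𝟙 (∧-not (p i) ⌊ a ≟ i ⌋))) ⟩
    suc (∑[ i < n ] 𝟙 (p i ∧ not ⌊ a ≟ i ⌋))
      ≡⟨ cong suc (countB≡∑ (λ i → p i ∧ not ⌊ a ≟ i ⌋)) ⟨
    suc (countB (λ i → p i ∧ not ⌊ a ≟ i ⌋)) ∎
    where
    open ≤-Reasoning
    ∧-not : ∀ b c → (if c then false else b) ≡ b ∧ not c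
    ∧-not b true = sym (∧-zeroʳ b)
    ∧-not b false = sym (∧-identityʳ b)
    𝟙≤1 : ∀ b → 𝟙 b ≤ 1
    𝟙≤1 true = ≤-refl
    𝟙≤1 false = z≤n

  count-∧ˡ : (b : Bool) (q : Fin n → Bool) → countB (λ i → b ∧ q i) ≡ (if b then countB q else 0)
  count-∧ˡ true q = refl
  count-∧ˡ false q = count-none λ _ → refl

-- Branchings and reachability

module _ {n : ℕ} where

  IsBranching : Arcs n → Set
  IsBranching F = ∀ {u v w} → F u w ≡ true → F v w ≡ true → u ≡ v

  IsSource : Arcs n → Fin n → Set
  IsSource F r = ∀ u → F u r ≡ false

  source-no-arc : ∀ {F : Arcs n} {r u} → IsSource F r → F u r ≢ true
  source-no-arc {u = u} source ur = contradiction (trans (sym (source u)) ur) λ ()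

  module _ {F : Arcs n} where

    Reach-snoc : ∀ {a b c} → Reach F a b → F b c ≡ true → Reach F a c
    Reach-snoc here bc = step bc here
    Reach-snoc (step ab b⇝c) cd = step ab (Reach-snoc b⇝c cd)

    Reach-last : ∀ {a b} → Reach F a b → a ≡ b ⊎ ∃ λ p → Reach F a p × F p b ≡ true
    Reach-last here = inj₁ refl
    Reach-last (step ab b⇝c) with Reach-last b⇝c
    ... | inj₁ refl = inj₂ (_ , here , ab)
    ... | inj₂ (p , b⇝p , pc) = inj₂ (p , step ab b⇝p , pc)

    Reach-to-source : ∀ {a s} → IsSource F s → Reach F a s → a ≡ s
    Reach-to-source source a⇝s with Reach-last a⇝s
    ... | inj₁ a≡s = a≡s
    ... | inj₂ (_ , _ , ps) = contradiction ps (source-no-arc {F = F} source)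

  module _ {F : Arcs n} (branching : IsBranching F) {r : Fin n} (source : IsSource F r) where

    Reach-pred : ∀ {b c} → Reach F r c → F b c ≡ true → Reach F r b
    Reach-pred r⇝c bc with Reach-last r⇝c
    ... | inj₁ refl = contradiction bc (source-no-arc {F = F} source)
    ... | inj₂ (p , r⇝p , pc) rewrite branching pc bc = r⇝p

    Reach-along-walk : ∀ k {a b} → reachK F k a b ≡ true → Reach F r a → Reach F r b
    Reach-along-walk zero {a} {b} a~b r⇝a with a ≟ b
    Reach-along-walk zero a~b r⇝a | yes refl = r⇝a
    Reach-along-walk zero () r⇝a | no _
    Reach-along-walk (suc k) a~b r⇝a with ∨-true⁻ a~b
    ... | inj₁ a~b′ = Reach-along-walk k a~b′ r⇝a
    ... | inj₂ via with any-true⁻ _ (allFin n) via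
    ... | c , _ , a~c×cb with ∧-true⁻ a~c×cb
    ... | a~c , cb-adj with ∨-true⁻ cb-adj
    ... | inj₁ cb = Reach-snoc (Reach-along-walk k a~c r⇝a) cb
    ... | inj₂ bc = Reach-pred (Reach-along-walk k a~c r⇝a) bc

    sources-reaching-same-node : ∀ {r′ w} → IsSource F r′ → Reach F r w → Reach F r′ w → r ≡ r′
    sources-reaching-same-node source′ r⇝w r′⇝w = Reach-to-source source′ (back r′⇝w)
      where
      back : ∀ {a} → Reach F a _ → Reach F r a
      back here = r⇝w
      back (step ab b⇝w) = Reach-pred (back b⇝w) ab

reachK-refl : ∀ {n} (F : Arcs n) k a → reachK F k a a ≡ true
reachK-refl F zero a = ⌊≟⌋-refl a
reachK-refl F (suc k) a rewrite reachK-refl F k a = refl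

sameComp-arc : ∀ {n} {F : Arcs n} {q w} → F q w ≡ true → sameComp F w q ≡ true
sameComp-arc {suc n} {F} {q} {w} qw =
  trans (cong (reachK F n w q ∨_) (any-true⁺ _ (∈-allFin w) (∧-true⁺ (reachK-refl F n w) w~q)))
        (∨-zeroʳ (reachK F n w q))
  where
  w~q : adj F w q ≡ true
  w~q = trans (cong (F w q ∨_) qw) (∨-zeroʳ (F w q))

-- Arcs and leaves

module _ {n : ℕ} where

  arcCount : Arcs n → ℕ
  arcCount F = ∑[ v < n ] outdeg F v

  excess : Arcs n → ℕ
  excess F = ∑[ v < n ] (outdeg F v ∸ 1)

  arcCount≡∑indeg : ∀ F → arcCount F ≡ ∑[ w < n ] indeg F w
  arcCount≡∑indeg F = begin
    ∑[ v < n ] outdeg F v              ≡⟨ sum-cong-≗ (countB≡∑ ∘ F) ⟩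
    ∑[ v < n ] ∑[ w < n ] 𝟙 (F v w)    ≡⟨ ∑-comm (λ v w → 𝟙 (F v w)) ⟩
    ∑[ w < n ] ∑[ v < n ] 𝟙 (F v w)    ≡⟨ sum-cong-≗ (λ w → countB≡∑ (λ v → F v w)) ⟨
    ∑[ w < n ] indeg F w               ∎
    where open ≡-Reasoning

  leaves+arcCount : ∀ F → leaves F + arcCount F ≡ n + excess F
  leaves+arcCount F = begin
    leaves F + arcCount F
      ≡⟨ cong (_+ arcCount F) (countB≡∑ (λ v → outdeg F v ≡ᵇ 0)) ⟩
    ∑[ v < n ] 𝟙 (outdeg F v ≡ᵇ 0) + arcCount F
      ≡⟨ ∑-distrib-+ (λ v → 𝟙 (outdeg F v ≡ᵇ 0)) (outdeg F) ⟨
    ∑[ v < n ] (𝟙 (outdeg F v ≡ᵇ 0) + outdeg F v)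
      ≡⟨ sum-cong-≗ (λ v → leaf-or-excess (outdeg F v)) ⟩
    ∑[ v < n ] (1 + (outdeg F v ∸ 1))
      ≡⟨ ∑-distrib-+ (λ _ → 1) (λ v → outdeg F v ∸ 1) ⟩
    ∑[ v < n ] 1 + excess F
      ≡⟨ cong (_+ excess F) (∑-const-1 n) ⟩
    n + excess F ∎
    where
    open ≡-Reasoning
    leaf-or-excess : ∀ m → 𝟙 (m ≡ᵇ 0) + m ≡ 1 + (m ∸ 1)
    leaf-or-excess zero = refl
    leaf-or-excess (suc m) = refl

  arcCount<n : ∀ {F r} → IsBranching F → IsSource F r → arcCount F < n
  arcCount<n {F} {r} branching source = begin
    suc (arcCount F)
      ≡⟨ cong suc (arcCount≡∑indeg F) ⟩
    suc (∑[ w < n ] indeg F w)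
      ≤⟨ s≤s (sum-mono-≤ indeg≤𝟙) ⟩
    suc (∑[ w < n ] 𝟙 (if ⌊ r ≟ w ⌋ then false else true))
      ≡⟨ ∑𝟙-extract r (λ _ → true) ⟨
    ∑[ w < n ] 1
      ≡⟨ ∑-const-1 n ⟩
    n ∎
    where
    open ≤-Reasoning
    indeg≤𝟙 : ∀ w → indeg F w ≤ 𝟙 (if ⌊ r ≟ w ⌋ then false else true)
    indeg≤𝟙 w with r ≟ w
    ... | yes refl = ≤-reflexive (count-none source)
    ... | no _ = count≤1 branching

  leaves-bound : ∀ {F r} → IsBranching F → IsSource F r → suc (excess F) ≤ leaves F
  leaves-bound {F} branching source = +-cancelˡ-≤ (arcCount F) _ _ (begin
    arcCount F + suc (excess F) ≡⟨ +-suc (arcCount F) (excess F) ⟩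
    suc (arcCount F) + excess F ≤⟨ +-monoˡ-≤ (excess F) (arcCount<n branching source) ⟩
    n + excess F               ≡⟨ leaves+arcCount F ⟨
    leaves F + arcCount F      ≡⟨ +-comm (leaves F) (arcCount F) ⟩
    arcCount F + leaves F      ∎)
    where open ≤-Reasoning

-- Counting the components of a branching

¬¬-∀-Fin : ∀ {n} {Q : Fin n → Set} → (∀ i → ¬ ¬ Q i) → ¬ ¬ (∀ i → Q i)
¬¬-∀-Fin {zero} _ k = k λ ()
¬¬-∀-Fin {suc n} ¬¬Q k = ¬¬Q zero λ q₀ → ¬¬-∀-Fin (¬¬Q ∘ suc) λ qs → k λ { zero → q₀ ; (suc i) → qs i }

least-Fin : ∀ {n} {P : Fin n → Set} → (∀ i → Dec (P i)) → ∀ {r} → P r →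
  ∃ λ w → P w × (∀ {w′} → toℕ w′ < toℕ w → ¬ P w′)
least-Fin {suc n} P? {r} Pr with P? zero
... | yes P₀ = zero , P₀ , λ ()
least-Fin {suc n} P? {zero} Pr | no ¬P₀ = contradiction Pr ¬P₀
least-Fin {suc n} P? {suc r} Pr | no ¬P₀ with least-Fin (P? ∘ suc) Pr
... | w , Pw , least = suc w , Pw , λ { {zero} _ → ¬P₀ ; {suc w′} (s≤s w′<w) → least w′<w }

module _ {n : ℕ} (F : Arcs n) where

  isComponentRoot : Fin n → Bool
  isComponentRoot v = inNontrivial F v ∧ (indeg F v ≡ᵇ 0)

  isLeastOfComponent : Fin n → Bool
  isLeastOfComponent v = inNontrivial F v ∧ all (λ w → not ((toℕ w <ᵇ toℕ v) ∧ sameComp F v w)) nodes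

-- A root is sent to the least node it reaches; this is the least node of its component since, in a
-- branching, undirected walks from nodes reached from a source only visit nodes reached from it.
module ComponentRoots {n : ℕ} {F : Arcs n} (branching : IsBranching F)
                      (reach? : ∀ r w → Dec (Reach F r w)) where

  least-reached : ∀ r → ∃ λ w → Reach F r w × (∀ {w′} → toℕ w′ < toℕ w → ¬ Reach F r w′)
  least-reached r = least-Fin (reach? r) here

  leastReached : Fin n → Fin n
  leastReached r = proj₁ (least-reached r)

  root-source : ∀ {r} → isComponentRoot F r ≡ true → IsSource F r
  root-source root = count-zero (≡ᵇ-true⇒≡ (proj₂ (∧-true⁻ root)))

  leastReached-isLeast : ∀ {r} → isComponentRoot F r ≡ true →
    isLeastOfComponent F (leastReached r) ≡ true
  leastReached-isLeast {r} root = ∧-true⁺ nontrivial (all-true _ nodes no-smaller)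
    where
    w = leastReached r
    r⇝w = proj₁ (proj₂ (least-reached r))

    nontrivial : inNontrivial F w ≡ true
    nontrivial with Reach-last r⇝w
    ... | inj₁ r≡w = subst (λ v → inNontrivial F v ≡ true) r≡w (proj₁ (∧-true⁻ root))
    ... | inj₂ (q , _ , qw) =
      any-true⁺ (λ v → sameComp F w v ∧ (0 <ᵇ outdeg F v)) (∈-allFin q)
        (∧-true⁺ (sameComp-arc {F = F} qw) (T⇒≡true (<⇒<ᵇ (count-witness {p = F q} qw))))

    no-smaller : ∀ w′ → not ((toℕ w′ <ᵇ toℕ w) ∧ sameComp F w w′) ≡ true
    no-smaller w′ with toℕ w′ <ᵇ toℕ w in w′<w | sameComp F w w′ in w~w′
    ... | false | _ = refl
    ... | true | false = refl
    ... | true | true = contradiction (Reach-along-walk branching (root-source root) n w~w′ r⇝w)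
                                      (proj₂ (proj₂ (least-reached r)) (<ᵇ⇒< _ _ (≡true⇒T w′<w)))

  leastReached-injective : ∀ {r r′} → isComponentRoot F r ≡ true → isComponentRoot F r′ ≡ true →
    leastReached r ≡ leastReached r′ → r ≡ r′
  leastReached-injective {r} {r′} root root′ same =
    sources-reaching-same-node branching (root-source root) (root-source root′)
      (proj₁ (proj₂ (least-reached r)))
      (subst (Reach F r′) (sym same) (proj₁ (proj₂ (least-reached r′))))

  roots≤components : countB (isComponentRoot F) ≤ kcomp F
  roots≤components = count-injective-≤ (isComponentRoot F) (isLeastOfComponent F) leastReached
                       leastReached-isLeast leastReached-injective

module _ {n : ℕ} {F : Arcs n} (branching : IsBranching F) where

  -- reachability is only decidable classically here, which suffices since the goal is decidable
  roots≤components : countB (isComponentRoot F) ≤ kcomp F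
  roots≤components = decidable-stable (countB (isComponentRoot F) ≤? kcomp F) λ ≰ →
    ¬¬-∀-Fin (λ r → ¬¬-∀-Fin λ w → ¬¬-excluded-middle) λ reach? →
      ≰ (ComponentRoots.roots≤components branching reach?)

  Ncomp≤arcCount+kcomp : Ncomp F ≤ arcCount F + kcomp F
  Ncomp≤arcCount+kcomp = begin
    Ncomp F
      ≡⟨ countB≡∑ (inNontrivial F) ⟩
    ∑[ v < n ] 𝟙 (inNontrivial F v)
      ≤⟨ sum-mono-≤ (λ v → nonroot-has-in-arc (inNontrivial F v) (indeg F v)) ⟩
    ∑[ v < n ] (indeg F v + 𝟙 (isComponentRoot F v))
      ≡⟨ ∑-distrib-+ (indeg F) (𝟙 ∘ isComponentRoot F) ⟩
    ∑[ v < n ] indeg F v + ∑[ v < n ] 𝟙 (isComponentRoot F v)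
      ≡⟨ cong (∑[ v < n ] indeg F v +_) (countB≡∑ (isComponentRoot F)) ⟨
    ∑[ v < n ] indeg F v + countB (isComponentRoot F)
      ≤⟨ +-monoʳ-≤ (∑[ v < n ] indeg F v) roots≤components ⟩
    ∑[ v < n ] indeg F v + kcomp F
      ≡⟨ cong (_+ kcomp F) (arcCount≡∑indeg F) ⟨
    arcCount F + kcomp F ∎
    where
    open ≤-Reasoning
    nonroot-has-in-arc : ∀ b m → 𝟙 b ≤ m + 𝟙 (b ∧ (m ≡ᵇ 0))
    nonroot-has-in-arc b zero rewrite ∧-identityʳ b = ≤-refl
    nonroot-has-in-arc true (suc m) = s≤s z≤n
    nonroot-has-in-arc false (suc m) = z≤n

-- GreedyExpand

module _ {n : ℕ} where

  _⊆ᴬ_ : Arcs n → Arcs n → Set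
  F ⊆ᴬ G = ∀ {u w} → F u w ≡ true → G u w ≡ true

  data RowGrowth (t : ℕ) (F G : Arcs n) (w : Fin n) : Set where
    kept  : (∀ u → G w u ≡ F w u) → RowGrowth t F G w
    grown : outdeg F w ≡ 0 → t ≤ outdeg G w → RowGrowth t F G w

  RowGrowth-trans : ∀ {t F G H w} → 1 ≤ t → RowGrowth t F G w → RowGrowth t G H w → RowGrowth t F H w
  RowGrowth-trans _ (kept F=G) (kept G=H) = kept λ u → trans (G=H u) (F=G u)
  RowGrowth-trans _ (kept F=G) (grown G-leaf H-many) =
    grown (trans (count-cong (sym ∘ F=G)) G-leaf) H-many
  RowGrowth-trans _ (grown F-leaf G-many) (kept G=H) =
    grown F-leaf (≤-trans G-many (≤-reflexive (count-cong (sym ∘ G=H))))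
  RowGrowth-trans 1≤t (grown _ G-many) (grown G-leaf _) =
    contradiction (≤-trans 1≤t (≤-trans G-many (≤-reflexive G-leaf))) λ ()

module Greedy {n : ℕ} (D : Arcs n) (t : ℕ) where

  Aset-arc : ∀ {F v u w} → Aset D F v u w ≡ true → u ≡ v × D v w ≡ true × IsSource F w
  Aset-arc {F} {v} {u} {w} e with u ≟ v
  ... | yes refl = let vw , source = ∧-true⁻ e in refl , vw , count-zero (≡ᵇ-true⇒≡ source)
  ... | no _ with () ← e

  greedyStep-cases : ∀ F v →
    greedyStep D t F v ≡ F ⊎
    (greedyStep D t F v ≡ union F (Aset D F v) × outdeg F v ≡ 0 × t ≤ outdeg (Aset D F v) v)
  greedyStep-cases F v with (outdeg F v ≡ᵇ 0) ∧ (t ≤ᵇ outdeg (Aset D F v) v) in fires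
  ... | false = inj₁ refl
  ... | true = let leaf , many = ∧-true⁻ fires in inj₂ (refl , ≡ᵇ-true⇒≡ leaf , ≤ᵇ-true⇒≤ many)

  union-Aset-branching : ∀ {F v} → IsBranching F → IsBranching (union F (Aset D F v))
  union-Aset-branching {F} {v} branching {u} {u′} {w} e e′ with ∨-true⁻ {F u w} e | ∨-true⁻ {F u′ w} e′
  ... | inj₁ old | inj₁ old′ = branching old old′
  ... | inj₁ old | inj₂ new′ =
    contradiction old (source-no-arc {F = F} (proj₂ (proj₂ (Aset-arc {F} {v} {u′} new′))))
  ... | inj₂ new | inj₁ old′ =
    contradiction old′ (source-no-arc {F = F} (proj₂ (proj₂ (Aset-arc {F} {v} {u} new))))
  ... | inj₂ new | inj₂ new′ =
    trans (proj₁ (Aset-arc {F} {v} {u} new)) (sym (proj₁ (Aset-arc {F} {v} {u′} new′)))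

  greedyExpand-branching : ∀ ord {F} → IsBranching F → IsBranching (greedyExpand D t ord F)
  greedyExpand-branching [] branching = branching
  greedyExpand-branching (v ∷ ord) {F} branching with greedyStep-cases F v
  ... | inj₁ unchanged = greedyExpand-branching ord (subst IsBranching (sym unchanged) branching)
  ... | inj₂ (fired , _) =
    greedyExpand-branching ord (subst IsBranching (sym fired) (union-Aset-branching {F} {v} branching))

  greedyExpand-⊆ : ∀ ord {F} → F ⊆ᴬ D → greedyExpand D t ord F ⊆ᴬ D
  greedyExpand-⊆ [] F⊆D = F⊆D
  greedyExpand-⊆ (v ∷ ord) {F} F⊆D with greedyStep-cases F v
  ... | inj₁ unchanged = greedyExpand-⊆ ord (subst (_⊆ᴬ D) (sym unchanged) F⊆D)
  ... | inj₂ (fired , _) = greedyExpand-⊆ ord (subst (_⊆ᴬ D) (sym fired) union⊆D)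
    where
    union⊆D : union F (Aset D F v) ⊆ᴬ D
    union⊆D {u} {w} e with ∨-true⁻ {F u w} e
    ... | inj₁ old = F⊆D old
    ... | inj₂ new with Aset-arc {F} {v} {u} {w} new
    ... | refl , vw , _ = vw

  greedyStep-row : ∀ F v w → RowGrowth t F (greedyStep D t F v) w
  greedyStep-row F v w with greedyStep-cases F v
  ... | inj₁ unchanged rewrite unchanged = kept λ _ → refl
  ... | inj₂ (fired , leaf , many) rewrite fired with w ≟ v
  ...   | yes refl = grown leaf (≤-trans many (≤-reflexive (count-cong λ u →
                       cong (_∨ Aset D F v v u) (sym (count-zero {p = F v} leaf u)))))
  ...   | no w≢v = kept λ u →
    trans (cong (λ b → F w u ∨ (b ∧ D v u ∧ (indeg F u ≡ᵇ 0))) (⌊≟⌋-≢ w≢v)) (∨-identityʳ (F w u))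

  greedyExpand-row : 1 ≤ t → ∀ ord F w → RowGrowth t F (greedyExpand D t ord F) w
  greedyExpand-row 1≤t [] F w = kept λ _ → refl
  greedyExpand-row 1≤t (v ∷ ord) F w =
    RowGrowth-trans 1≤t (greedyStep-row F v w) (greedyExpand-row 1≤t ord (greedyStep D t F v) w)

-- MaxLeaves-12MIS

module _ {n : ℕ} {v : Fin n} where

  ∈-elemsAt⁻ : ∀ {x} → x ∈ elemsAt v → ∃ λ m → x ≡ (v , m)
  ∈-elemsAt⁻ (here refl) = nothing , refl
  ∈-elemsAt⁻ (there x∈) with ∈-map⁻ (λ u → (v , just u)) x∈
  ... | u , _ , refl = just u , refl

  ∈-elemsAt⁺ : ∀ m → (v , m) ∈ elemsAt v
  ∈-elemsAt⁺ nothing = here refl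
  ∈-elemsAt⁺ (just u) = there (∈-map⁺ (λ u → (v , just u)) (∈-allFin u))

  any-elemsAt⁻ : (g : Elem → Bool) → any g (elemsAt v) ≡ true → ∃ λ m → g (v , m) ≡ true
  any-elemsAt⁻ g e with any-true⁻ g (elemsAt v) e
  ... | x , x∈ , gx with ∈-elemsAt⁻ x∈
  ... | m , refl = m , gx

  any-elemsAt-false : (g : Elem → Bool) → (∀ m → g (v , m) ≢ true) → any g (elemsAt v) ≡ false
  any-elemsAt-false g none = any-false g (elemsAt v) λ x∈ gx →
    let m , x≡vm = ∈-elemsAt⁻ x∈ in none m (subst (λ x → g x ≡ true) x≡vm gx)

-- The weights 1, 2, 6 make these row bounds tight at out-degree 4 in F₁ and at a chosen x with
-- |U_x| = 2 or 3.

empty-row-bound : ∀ {d₁ d₂ d₃ e} → d₁ ≡ 0 → d₂ ≡ d₁ → d₃ ≡ d₁ → d₁ + 2 * d₂ + 6 * d₃ ≤ e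
empty-row-bound refl refl refl = z≤n

inner-row-bound : ∀ {d₁ d₂ d₃ dT} → 4 ≤ d₁ → d₂ ≡ d₁ → d₃ ≡ d₁ → dT ≡ d₁ →
  d₁ + 2 * d₂ + 6 * d₃ ≤ 12 * (dT ∸ 1)
inner-row-bound (s≤s (s≤s (s≤s (s≤s {n = k} _)))) refl refl refl =
  ≤-trans (m≤m+n _ (3 * k)) (≤-reflexive (identity k))
  where
  identity : ∀ k → (4 + k) + 2 * (4 + k) + 6 * (4 + k) + 3 * k ≡ 12 * (3 + k)
  identity = solve-∀

chosen-row-bound : ∀ {d₁ d₂ d₃ dT s} → 2 ≤ s →
  d₁ ≡ 0 → d₂ ≡ (if s ≡ᵇ 3 then s else 0) → d₃ ≡ s → dT ≡ s →
  d₁ + 2 * d₂ + 6 * d₃ ≤ 12 * (dT ∸ 1)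
chosen-row-bound (s≤s (s≤s {n = 0} _)) refl refl refl refl = ≤-refl
chosen-row-bound (s≤s (s≤s {n = 1} _)) refl refl refl refl = ≤-refl
chosen-row-bound (s≤s (s≤s {n = suc (suc k)} _)) refl refl refl refl =
  ≤-trans (m≤m+n _ (12 + 6 * k)) (≤-reflexive (identity k))
  where
  identity : ∀ k → 6 * (4 + k) + (12 + 6 * k) ≡ 12 * (3 + k)
  identity = solve-∀

weighted-bound : ∀ {N₁ N₂ N₃ a₁ a₂ a₃ k₁ k₂ k₃ e ℓ} →
  N₁ ≤ a₁ + k₁ → N₂ ≤ a₂ + k₂ → N₃ ≤ a₃ + k₃ → a₁ + 2 * a₂ + 6 * a₃ ≤ 12 * e → suc e ≤ ℓ →
  N₁ + 2 * N₂ + 6 * N₃ + 12 ≤ 12 * ℓ + k₁ + 2 * k₂ + 6 * k₃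
weighted-bound {N₁} {N₂} {N₃} {a₁} {a₂} {a₃} {k₁} {k₂} {k₃} {e} {ℓ} N₁≤ N₂≤ N₃≤ a≤ e<ℓ = begin
  N₁ + 2 * N₂ + 6 * N₃ + 12
    ≤⟨ +-monoˡ-≤ 12 (+-mono-≤ (+-mono-≤ N₁≤ (*-monoʳ-≤ 2 N₂≤)) (*-monoʳ-≤ 6 N₃≤)) ⟩
  (a₁ + k₁) + 2 * (a₂ + k₂) + 6 * (a₃ + k₃) + 12
    ≡⟨ regroup a₁ a₂ a₃ k₁ k₂ k₃ ⟩
  (a₁ + 2 * a₂ + 6 * a₃) + 12 + K
    ≤⟨ +-monoˡ-≤ K (+-monoˡ-≤ 12 a≤) ⟩
  12 * e + 12 + K
    ≡⟨ cong (_+ K) (trans (+-comm (12 * e) 12) (sym (*-suc 12 e))) ⟩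
  12 * suc e + K
    ≤⟨ +-monoˡ-≤ K (*-monoʳ-≤ 12 e<ℓ) ⟩
  12 * ℓ + K
    ≡⟨ unbracket ℓ k₁ k₂ k₃ ⟩
  12 * ℓ + k₁ + 2 * k₂ + 6 * k₃ ∎
  where
  open ≤-Reasoning
  K = k₁ + 2 * k₂ + 6 * k₃
  regroup : ∀ a₁ a₂ a₃ k₁ k₂ k₃ → (a₁ + k₁) + 2 * (a₂ + k₂) + 6 * (a₃ + k₃) + 12
                                  ≡ (a₁ + 2 * a₂ + 6 * a₃) + 12 + (k₁ + 2 * k₂ + 6 * k₃)
  regroup = solve-∀
  unbracket : ∀ ℓ k₁ k₂ k₃ → 12 * ℓ + (k₁ + 2 * k₂ + 6 * k₃) ≡ 12 * ℓ + k₁ + 2 * k₂ + 6 * k₃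
  unbracket = solve-∀

module MaxLeaves {n : ℕ} (D : Arcs n) (ord₁ ord₂ : List (Fin n)) (I : Elem → Bool)
                 (independent : IsIndependent D ord₁ I) where

  open Greedy

  F₁-branching : IsBranching (F₁ D ord₁)
  F₁-branching = greedyExpand-branching D 4 ord₁ λ ()

  F₁⊆D : F₁ D ord₁ ⊆ᴬ D
  F₁⊆D = greedyExpand-⊆ D 4 ord₁ λ ()

  F₁-row : ∀ v → outdeg (F₁ D ord₁) v ≡ 0 ⊎ 4 ≤ outdeg (F₁ D ord₁) v
  F₁-row v with greedyExpand-row D 4 (s≤s z≤n) ord₁ emptyArcs v
  ... | kept empty = inj₁ (count-none empty)
  ... | grown _ many = inj₂ many

  Ux⇒Uv : ∀ x {u} → Ux D ord₁ x u ≡ true → Uv D ord₁ (proj₁ x) u ≡ true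
  Ux⇒Uv (v , nothing) vu = vu
  Ux⇒Uv (v , just _) vu = proj₁ (∧-true⁻ vu)

  Uv⇒source : ∀ {v u} → Uv D ord₁ v u ≡ true → IsSource (F₁ D ord₁) u
  Uv⇒source vu = count-zero (≡ᵇ-true⇒≡ (proj₂ (∧-true⁻ vu)))

  candidate-leaf : ∀ x → isCandidate D ord₁ x ≡ true → outdeg (F₁ D ord₁) (proj₁ x) ≡ 0
  candidate-leaf (v , nothing) c = ≡ᵇ-true⇒≡ (proj₁ (∧-true⁻ {outdeg (F₁ D ord₁) v ≡ᵇ 0} c))
  candidate-leaf (v , just _) c = ≡ᵇ-true⇒≡ (proj₁ (∧-true⁻ {outdeg (F₁ D ord₁) v ≡ᵇ 0} c))

  candidate-size : ∀ x → isCandidate D ord₁ x ≡ true → 2 ≤ sizeUx D ord₁ x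
  candidate-size (v , nothing) c =
    ≤ᵇ-true⇒≤ (proj₁ (∧-true⁻ (proj₂ (∧-true⁻ {outdeg (F₁ D ord₁) v ≡ᵇ 0} c))))
  candidate-size (v , just u) c = ≤-pred (begin
    3
      ≡⟨ ≡ᵇ-true⇒≡ (proj₁ (∧-true⁻ (proj₂ (∧-true⁻ {outdeg (F₁ D ord₁) v ≡ᵇ 0} c)))) ⟨
    sizeU D ord₁ v
      ≤⟨ count-remove (Uv D ord₁ v) u ⟩
    suc (sizeUx D ord₁ (v , just u)) ∎)
    where open ≤-Reasoning

  Ux-witness : ∀ x → isCandidate D ord₁ x ≡ true → ∃ λ u → Ux D ord₁ x u ≡ true
  Ux-witness x c = count-positive {p = Ux D ord₁ x} (≤-trans (s≤s z≤n) (candidate-size x c))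

  candidates-overlap : ∀ v m m′ →
    isCandidate D ord₁ (v , m) ≡ true → isCandidate D ord₁ (v , m′) ≡ true →
    ∃ λ u → Ux D ord₁ (v , m) u ≡ true × Ux D ord₁ (v , m′) u ≡ true
  candidates-overlap v nothing nothing c _ =
    let u , vu = Ux-witness (v , nothing) c in u , vu , vu
  candidates-overlap v nothing (just a) _ c′ =
    let u , vu = Ux-witness (v , just a) c′ in u , Ux⇒Uv (v , just a) vu , vu
  candidates-overlap v (just a) nothing c _ =
    let u , vu = Ux-witness (v , just a) c in u , vu , Ux⇒Uv (v , just a) vu
  candidates-overlap v (just a) (just b) c _ =
    let u , vu = count-positive {p = λ u → Ux D ord₁ (v , just a) u ∧ not ⌊ b ≟ u ⌋}
                   (≤-pred (≤-trans (candidate-size (v , just a) c)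
                                    (count-remove (Ux D ord₁ (v , just a)) b)))
        va , b≢u = ∧-true⁻ vu
    in u , va , ∧-true⁺ (Ux⇒Uv (v , just a) va) b≢u

  chosen-unique : ∀ {v m m′} → I (v , m) ≡ true → I (v , m′) ≡ true → m ≡ m′
  chosen-unique {v} {m} {m′} chosen chosen′ with ≡-dec _≟_ m m′
  ... | yes m≡m′ = m≡m′
  ... | no m≢m′ =
    let u , x , y = candidates-overlap v m m′ (proj₁ independent _ chosen) (proj₁ independent _ chosen′)
    in ⊥-elim (proj₂ independent _ _ chosen chosen′ (m≢m′ ∘ cong proj₂) u x y)

  chosen-or-not : ∀ v → (∃ λ m → I (v , m) ≡ true) ⊎ (∀ m → I (v , m) ≡ false)
  chosen-or-not v with any I (elemsAt v) in some
  ... | true = inj₁ (any-elemsAt⁻ I some)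
  ... | false = inj₂ λ m → ¬-not λ chosen →
    contradiction (trans (sym (any-true⁺ I (∈-elemsAt⁺ m) chosen)) some) λ ()

  module _ (sel : Elem {n} → Bool) where

    addsArcTo : Fin n → Elem → Bool
    addsArcTo w x = I x ∧ sel x ∧ Ux D ord₁ x w

    addArcs-arc⁻ : ∀ {u w} → addArcs D ord₁ I sel u w ≡ true →
      F₁ D ord₁ u w ≡ true ⊎ ∃ λ m → I (u , m) ≡ true × Ux D ord₁ (u , m) w ≡ true
    addArcs-arc⁻ {u} {w} e with ∨-true⁻ {F₁ D ord₁ u w} e
    ... | inj₁ old = inj₁ old
    ... | inj₂ new with any-elemsAt⁻ (addsArcTo w) new
    ... | m , adds = let chosen , selected = ∧-true⁻ adds in inj₂ (m , chosen , proj₂ (∧-true⁻ selected))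

    addArcs-branching : IsBranching (addArcs D ord₁ I sel)
    addArcs-branching {u} {u′} {w} e e′ with addArcs-arc⁻ e | addArcs-arc⁻ e′
    ... | inj₁ old | inj₁ old′ = F₁-branching old old′
    ... | inj₁ old | inj₂ (m′ , _ , new′) =
      contradiction old (source-no-arc {F = F₁ D ord₁} (Uv⇒source (Ux⇒Uv (u′ , m′) new′)))
    ... | inj₂ (m , _ , new) | inj₁ old′ =
      contradiction old′ (source-no-arc {F = F₁ D ord₁} (Uv⇒source (Ux⇒Uv (u , m) new)))
    ... | inj₂ (m , chosen , new) | inj₂ (m′ , chosen′ , new′) with u ≟ u′
    ...   | yes u≡u′ = u≡u′
    ...   | no u≢u′ = ⊥-elim (proj₂ independent _ _ chosen chosen′ (u≢u′ ∘ cong proj₁) w new new′)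

    addArcs⊆D : addArcs D ord₁ I sel ⊆ᴬ D
    addArcs⊆D e with addArcs-arc⁻ e
    ... | inj₁ old = F₁⊆D old
    ... | inj₂ (m , _ , new) = proj₁ (∧-true⁻ (Ux⇒Uv (_ , m) new))

    outdeg-unchosen : ∀ {v} → (∀ m → I (v , m) ≡ false) →
      outdeg (addArcs D ord₁ I sel) v ≡ outdeg (F₁ D ord₁) v
    outdeg-unchosen {v} none = count-cong λ u →
      trans (cong (F₁ D ord₁ v u ∨_) (any-elemsAt-false (addsArcTo u) λ m e →
               contradiction (trans (sym (none m)) (proj₁ (∧-true⁻ {I (v , m)} e))) λ ()))
            (∨-identityʳ (F₁ D ord₁ v u))

    outdeg-chosen : ∀ {v m} → I (v , m) ≡ true →
      outdeg (addArcs D ord₁ I sel) v ≡ (if sel (v , m) then sizeUx D ord₁ (v , m) else 0)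
    outdeg-chosen {v} {m} chosen =
      trans (count-cong row) (count-∧ˡ (sel (v , m)) (Ux D ord₁ (v , m)))
      where
      leaf : outdeg (F₁ D ord₁) v ≡ 0
      leaf = candidate-leaf (v , m) (proj₁ independent (v , m) chosen)

      row : ∀ u → addArcs D ord₁ I sel v u ≡ sel (v , m) ∧ Ux D ord₁ (v , m) u
      row u rewrite count-zero {p = F₁ D ord₁ v} leaf u
        with sel (v , m) ∧ Ux D ord₁ (v , m) u in selected
      ... | true =
        any-true⁺ (addsArcTo u) (∈-elemsAt⁺ m)
          (trans (cong (_∧ sel (v , m) ∧ Ux D ord₁ (v , m) u) chosen) selected)
      ... | false = any-elemsAt-false (addsArcTo u) λ m′ e →
        let chosen′ , selected′ = ∧-true⁻ {I (v , m′)} e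
            selected″ = subst (λ k → sel (v , k) ∧ Ux D ord₁ (v , k) u ≡ true)
                              (chosen-unique chosen′ chosen) selected′
        in contradiction (trans (sym selected) selected″) λ ()

  T-branching : IsBranching (Tout D ord₁ ord₂ I)
  T-branching = greedyExpand-branching D 1 ord₂ (addArcs-branching (λ _ → true))

  T⊆D : Tout D ord₁ ord₂ I ⊆ᴬ D
  T⊆D = greedyExpand-⊆ D 1 ord₂ (addArcs⊆D (λ _ → true))

  T-outdeg : ∀ v → 1 ≤ outdeg (F₃ D ord₁ I) v → outdeg (Tout D ord₁ ord₂ I) v ≡ outdeg (F₃ D ord₁ I) v
  T-outdeg v nonleaf with greedyExpand-row D 1 ≤-refl ord₂ (F₃ D ord₁ I) v
  ... | kept same = count-cong same
  ... | grown leaf _ = contradiction (≤-trans nonleaf (≤-reflexive leaf)) λ ()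

  outdeg-bound : ∀ v →
    outdeg (F₁ D ord₁) v + 2 * outdeg (F₂ D ord₁ I) v + 6 * outdeg (F₃ D ord₁ I) v
      ≤ 12 * (outdeg (Tout D ord₁ ord₂ I) v ∸ 1)
  outdeg-bound v with chosen-or-not v
  ... | inj₁ (m , chosen) =
    chosen-row-bound size (candidate-leaf (v , m) candidate) (outdeg-chosen (weight2 D ord₁) chosen) d₃
      (trans (T-outdeg v (≤-trans (s≤s z≤n) (≤-trans size (≤-reflexive (sym d₃))))) d₃)
    where
    candidate = proj₁ independent (v , m) chosen
    size = candidate-size (v , m) candidate
    d₃ = outdeg-chosen (λ _ → true) chosen
  ... | inj₂ none with F₁-row v
  ...   | inj₁ leaf =
    empty-row-bound leaf (outdeg-unchosen (weight2 D ord₁) none) (outdeg-unchosen (λ _ → true) none)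
  ...   | inj₂ many =
    inner-row-bound many (outdeg-unchosen (weight2 D ord₁) none) d₃
      (trans (T-outdeg v (≤-trans (s≤s z≤n) (≤-trans many (≤-reflexive (sym d₃))))) d₃)
    where
    d₃ = outdeg-unchosen (λ _ → true) none

  arcCount-bound : arcCount (F₁ D ord₁) + 2 * arcCount (F₂ D ord₁ I) + 6 * arcCount (F₃ D ord₁ I)
                     ≤ 12 * excess (Tout D ord₁ ord₂ I)
  arcCount-bound = begin
    ∑[ v < n ] d₁ v + 2 * ∑[ v < n ] d₂ v + 6 * ∑[ v < n ] d₃ v
      ≡⟨ cong₂ (λ x y → ∑[ v < n ] d₁ v + x + y) (*-distribˡ-sum 2 d₂) (*-distribˡ-sum 6 d₃) ⟩
    ∑[ v < n ] d₁ v + ∑[ v < n ] (2 * d₂ v) + ∑[ v < n ] (6 * d₃ v)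
      ≡⟨ cong (_+ ∑[ v < n ] (6 * d₃ v)) (∑-distrib-+ d₁ (λ v → 2 * d₂ v)) ⟨
    ∑[ v < n ] (d₁ v + 2 * d₂ v) + ∑[ v < n ] (6 * d₃ v)
      ≡⟨ ∑-distrib-+ (λ v → d₁ v + 2 * d₂ v) (λ v → 6 * d₃ v) ⟨
    ∑[ v < n ] (d₁ v + 2 * d₂ v + 6 * d₃ v)
      ≤⟨ sum-mono-≤ outdeg-bound ⟩
    ∑[ v < n ] (12 * (dT v ∸ 1))
      ≡⟨ *-distribˡ-sum 12 (λ v → dT v ∸ 1) ⟨
    12 * excess (Tout D ord₁ ord₂ I) ∎
    where
    open ≤-Reasoning
    d₁ d₂ d₃ dT : Fin n → ℕ
    d₁ = outdeg (F₁ D ord₁)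
    d₂ = outdeg (F₂ D ord₁ I)
    d₃ = outdeg (F₃ D ord₁ I)
    dT = outdeg (Tout D ord₁ ord₂ I)

lemma8 : (n : ℕ) (D : Arcs n) → IsDag D → Rooted D →
    (ord₁ ord₂ : List (Fin n)) → ord₁ ↭ allFin n → ord₂ ↭ allFin n →
    (I : Elem → Bool) → IsIndependent D ord₁ I →
    -- 12 ℓ(T) ≥ (N₁ - k₁) + 2 (N₂ - k₂) + 6 (N₃ - k₃) + 12, with the k's moved left
    Ncomp (F₁ D ord₁) + 2 * Ncomp (F₂ D ord₁ I) + 6 * Ncomp (F₃ D ord₁ I) + 12
      ≤ 12 * leaves (Tout D ord₁ ord₂ I)
        + kcomp (F₁ D ord₁) + 2 * kcomp (F₂ D ord₁ I) + 6 * kcomp (F₃ D ord₁ I)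
-- The bound holds for arbitrary node lists.
lemma8 n D dag (r , r-root) ord₁ ord₂ _ _ I independent =
  weighted-bound {k₁ = kcomp (F₁ D ord₁)} {k₂ = kcomp (F₂ D ord₁ I)} {k₃ = kcomp (F₃ D ord₁ I)}
    (Ncomp≤arcCount+kcomp F₁-branching)
    (Ncomp≤arcCount+kcomp (addArcs-branching (weight2 D ord₁)))
    (Ncomp≤arcCount+kcomp (addArcs-branching (λ _ → true)))
    arcCount-bound
    (leaves-bound T-branching r-source)
  where
  open MaxLeaves D ord₁ ord₂ I independent
  r-source : IsSource (Tout D ord₁ ord₂ I) r
  r-source u = ¬-not λ ur → dag u r (T⊆D ur) (r-root u)
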